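{- Every convex integer polygon in $\mathbb{R}^2$ contains a point of the lattice $\mathbb{Z}\times 2\mathbb{Z}=\{(u_1,2u_2): u_1,u_2\in\mathbb{Z}\}$, i.e. an integer point with even second coordinate.
   Context: A convex polygon is the convex hull of a finite subset of $\mathbb{R}^2$ having nonempty interior. It is an integer polygon if all its vertices belong to $\mathbb{Z}^2$. -}

module Defs where

open import Data.Nat using (ℕ; zero; suc)
open import Data.Fin using (Fin; zero; suc)
open import Data.Integer as ℤ using (ℤ)
open import Data.Rational as ℚ using (ℚ; 0ℚ; 1ℚ; _/_)
open import Data.Product using (_×_; _,_; proj₁; proj₂; Σ; ∃; ∃-syntax)
open import Relation.Binary.PropositionalEquality using (_≡_; _≢_)

Point : Set
Point = ℤ × ℤ

ιℚ : ℤ → ℚ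
ιℚ z = z / 1

Σℚ : (n : ℕ) → (Fin n → ℚ) → ℚ
Σℚ zero    f = 0ℚ
Σℚ (suc n) f = f zero ℚ.+ Σℚ n (λ i → f (suc i))

InConvexHull : (n : ℕ) → (Fin n → Point) → ℚ × ℚ → Set
InConvexHull n v (x , y) =
  Σ (Fin n → ℚ) λ λs →
    ((i : Fin n) → 0ℚ ℚ.≤ λs i) ×
    (Σℚ n λs ≡ 1ℚ) ×
    (Σℚ n (λ i → λs i ℚ.* ιℚ (proj₁ (v i))) ≡ x) ×
    (Σℚ n (λ i → λs i ℚ.* ιℚ (proj₂ (v i))) ≡ y)

det3 : Point → Point → Point → ℤ
det3 (a₁ , a₂) (b₁ , b₂) (c₁ , c₂) =
  (b₁ ℤ.- a₁) ℤ.* (c₂ ℤ.- a₂) ℤ.- (b₂ ℤ.- a₂) ℤ.* (c₁ ℤ.- a₁)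

-- The convex hull of the finite family has nonempty interior in ℝ²
-- iff the family contains three affinely independent (non-collinear) points.
NonemptyInterior : (n : ℕ) → (Fin n → Point) → Set
NonemptyInterior n v = ∃[ i ] ∃[ j ] ∃[ k ] (det3 (v i) (v j) (v k) ≢ ℤ.0ℤ)

{-# OPTIONS --safe #-}
-- The hull contains a lattice triangle of positive doubled area |det3|, spanned by
-- three of the given vertices. If a vertex of it has even second coordinate we are
-- done. Otherwise all three second coordinates are odd and, by pigeonhole, two
-- vertices have first coordinates of equal parity; their midpoint is then a lattice
-- point of the hull, and replacing one of the two by it halves |det3|. As |det3| is
-- a positive integer, this descent must stop at an even vertex.
module Submission where

open import Defs
open import Data.Nat using (ℕ)
open import Data.Fin using (Fin)
open import Data.Integer using (ℤ; _*_; +_)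
open import Data.Product using (_,_; ∃-syntax)

open import Algebra.Bundles using (CommutativeRing)
open import Data.Fin using (zero; suc)
open import Data.Integer as ℤ using (_+_; _-_; -_)
import Data.Integer.DivMod as ℤ
import Data.Integer.Properties as ℤ
open import Data.Integer.Solver using (module +-*-Solver)
open import Data.Integer.Tactic.RingSolver using (solve-∀)
open import Data.Nat as ℕ using (zero; suc; _<_; s≤s)
import Data.Nat.Properties as ℕ
open import Data.Nat.Induction using (<-wellFounded)
open import Data.Product using (_×_; proj₁; proj₂)
open import Data.Rational as ℚ using (ℚ; 0ℚ; 1ℚ; ½)
import Data.Rational.Properties as ℚ
import Data.Rational.Solver as ℚ
open import Data.Rational.Unnormalised as ℚᵘ using (mkℚᵘ; *≡*)
import Data.Rational.Unnormalised.Properties as ℚᵘ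
open import Data.Sum using (_⊎_; inj₁; inj₂)
open import Function using (_∘_)
open import Induction.WellFounded using (Acc; acc)
open import Relation.Binary.PropositionalEquality

open import Algebra.Properties.Semiring.Sum (CommutativeRing.semiring ℚ.+-*-commutativeRing)
  using (sum; sum-cong-≗; ∑-distrib-+; *-distribˡ-sum)

Σℚ≡sum : ∀ n (f : Fin n → ℚ) → Σℚ n f ≡ sum f
Σℚ≡sum zero    f = refl
Σℚ≡sum (suc n) f = cong (f zero ℚ.+_) (Σℚ≡sum n (f ∘ suc))

Σℚ-cong : ∀ n {f g : Fin n → ℚ} → (∀ i → f i ≡ g i) → Σℚ n f ≡ Σℚ n g
Σℚ-cong n {f} {g} f≗g = trans (Σℚ≡sum n f) (trans (sum-cong-≗ f≗g) (sym (Σℚ≡sum n g)))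

Σℚ-linear : ∀ n s t (f g : Fin n → ℚ) →
            Σℚ n (λ i → s ℚ.* f i ℚ.+ t ℚ.* g i) ≡ s ℚ.* Σℚ n f ℚ.+ t ℚ.* Σℚ n g
Σℚ-linear n s t f g = begin
  Σℚ n (λ i → s ℚ.* f i ℚ.+ t ℚ.* g i)   ≡⟨ Σℚ≡sum n _ ⟩
  sum (λ i → s ℚ.* f i ℚ.+ t ℚ.* g i)    ≡⟨ ∑-distrib-+ (λ i → s ℚ.* f i) (λ i → t ℚ.* g i) ⟩
  sum (λ i → s ℚ.* f i) ℚ.+ sum (λ i → t ℚ.* g i)
    ≡⟨ cong₂ ℚ._+_ (*-distribˡ-sum s f) (*-distribˡ-sum t g) ⟨
  s ℚ.* sum f ℚ.+ t ℚ.* sum g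
    ≡⟨ cong₂ (λ p q → s ℚ.* p ℚ.+ t ℚ.* q) (Σℚ≡sum n f) (Σℚ≡sum n g) ⟨
  s ℚ.* Σℚ n f ℚ.+ t ℚ.* Σℚ n g          ∎
  where open ≡-Reasoning

Σℚ-zero : ∀ n (f : Fin n → ℚ) → Σℚ n (λ i → 0ℚ ℚ.* f i) ≡ 0ℚ
Σℚ-zero n f = trans (Σℚ≡sum n _) (trans (sym (*-distribˡ-sum 0ℚ f)) (ℚ.*-zeroˡ (sum f)))

indicator : ∀ {n} → Fin n → Fin n → ℚ
indicator zero    zero    = 1ℚ
indicator zero    (suc _) = 0ℚ
indicator (suc _) zero    = 0ℚ
indicator (suc i) (suc j) = indicator i j

indicator-nonNeg : ∀ {n} (i j : Fin n) → 0ℚ ℚ.≤ indicator i j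
indicator-nonNeg zero    zero    = ℚ.nonNegative⁻¹ 1ℚ
indicator-nonNeg zero    (suc _) = ℚ.≤-refl
indicator-nonNeg (suc _) zero    = ℚ.≤-refl
indicator-nonNeg (suc i) (suc j) = indicator-nonNeg i j

Σℚ-indicator : ∀ {n} (i : Fin n) (f : Fin n → ℚ) → Σℚ n (λ j → indicator i j ℚ.* f j) ≡ f i
Σℚ-indicator {suc n} zero f =
  trans (cong₂ ℚ._+_ (ℚ.*-identityˡ (f zero)) (Σℚ-zero n (f ∘ suc))) (ℚ.+-identityʳ (f zero))
Σℚ-indicator {suc n} (suc i) f =
  trans (cong₂ ℚ._+_ (ℚ.*-zeroˡ (f zero)) (Σℚ-indicator i (f ∘ suc))) (ℚ.+-identityˡ (f (suc i)))

ιℚ-+ : ∀ a b → ιℚ (a + b) ≡ ιℚ a ℚ.+ ιℚ b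
ιℚ-+ a b = ℚ.toℚᵘ-injective (begin-equality
  ℚ.toℚᵘ (ιℚ (a + b))                  ≃⟨ ℚ.toℚᵘ-fromℚᵘ (mkℚᵘ (a + b) 0) ⟩
  mkℚᵘ (a + b) 0
    ≃⟨ *≡* (cong (_* + 1) (sym (cong₂ _+_ (ℤ.*-identityʳ a) (ℤ.*-identityʳ b)))) ⟩
  mkℚᵘ a 0 ℚᵘ.+ mkℚᵘ b 0
    ≃⟨ ℚᵘ.+-cong (ℚ.toℚᵘ-fromℚᵘ (mkℚᵘ a 0)) (ℚ.toℚᵘ-fromℚᵘ (mkℚᵘ b 0)) ⟨
  ℚ.toℚᵘ (ιℚ a) ℚᵘ.+ ℚ.toℚᵘ (ιℚ b)     ≃⟨ ℚ.toℚᵘ-homo-+ (ιℚ a) (ιℚ b) ⟨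
  ℚ.toℚᵘ (ιℚ a ℚ.+ ιℚ b)               ∎)
  where open ℚᵘ.≤-Reasoning

2*i≡i+i : ∀ i → + 2 * i ≡ i + i
2*i≡i+i i = trans (ℤ.*-distribʳ-+ i (+ 1) (+ 1)) (cong₂ _+_ (ℤ.*-identityˡ i) (ℤ.*-identityˡ i))

ιℚ-midpoint : ∀ a b {m} → a + b ≡ + 2 * m → ½ ℚ.* ιℚ a ℚ.+ ½ ℚ.* ιℚ b ≡ ιℚ m
ιℚ-midpoint a b {m} a+b≡2m = begin
  ½ ℚ.* ιℚ a ℚ.+ ½ ℚ.* ιℚ b   ≡⟨ ℚ.*-distribˡ-+ ½ (ιℚ a) (ιℚ b) ⟨
  ½ ℚ.* (ιℚ a ℚ.+ ιℚ b)       ≡⟨ cong (½ ℚ.*_) (ιℚ-+ a b) ⟨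
  ½ ℚ.* ιℚ (a + b)            ≡⟨ cong (λ z → ½ ℚ.* ιℚ z) (trans a+b≡2m (2*i≡i+i m)) ⟩
  ½ ℚ.* ιℚ (m + m)            ≡⟨ cong (½ ℚ.*_) (ιℚ-+ m m) ⟩
  ½ ℚ.* (ιℚ m ℚ.+ ιℚ m)       ≡⟨ solve 1 (λ x → con ½ :* (x :+ x) := x) refl (ιℚ m) ⟩
  ιℚ m                        ∎
  where
  open ≡-Reasoning
  open ℚ.+-*-Solver

*-nonNeg : ∀ {p q} → 0ℚ ℚ.≤ p → 0ℚ ℚ.≤ q → 0ℚ ℚ.≤ p ℚ.* q
*-nonNeg {p} {q} 0≤p 0≤q =
  subst (ℚ._≤ p ℚ.* q) (ℚ.*-zeroʳ p) (ℚ.*-monoˡ-≤-nonNeg p {{ℚ.nonNegative 0≤p}} 0≤q)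

InConvexHull-convex : ∀ {n v x y x′ y′} s t → 0ℚ ℚ.≤ s → 0ℚ ℚ.≤ t → s ℚ.+ t ≡ 1ℚ →
  InConvexHull n v (x , y) → InConvexHull n v (x′ , y′) →
  InConvexHull n v (s ℚ.* x ℚ.+ t ℚ.* x′ , s ℚ.* y ℚ.+ t ℚ.* y′)
InConvexHull-convex {n} {v} s t 0≤s 0≤t s+t≡1
  (λs , 0≤λs , Σλs≡1 , Σλx≡x , Σλy≡y) (μs , 0≤μs , Σμs≡1 , Σμx≡x′ , Σμy≡y′) =
  ν , 0≤ν , Σν≡1 ,
  coordinate (ιℚ ∘ proj₁ ∘ v) Σλx≡x Σμx≡x′ , coordinate (ιℚ ∘ proj₂ ∘ v) Σλy≡y Σμy≡y′
  where
  ν : Fin n → ℚ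
  ν i = s ℚ.* λs i ℚ.+ t ℚ.* μs i

  0≤ν : ∀ i → 0ℚ ℚ.≤ ν i
  0≤ν i = ℚ.+-mono-≤ (*-nonNeg 0≤s (0≤λs i)) (*-nonNeg 0≤t (0≤μs i))

  Σν≡1 : Σℚ n ν ≡ 1ℚ
  Σν≡1 = begin
    Σℚ n ν                           ≡⟨ Σℚ-linear n s t λs μs ⟩
    s ℚ.* Σℚ n λs ℚ.+ t ℚ.* Σℚ n μs  ≡⟨ cong₂ (λ p q → s ℚ.* p ℚ.+ t ℚ.* q) Σλs≡1 Σμs≡1 ⟩
    s ℚ.* 1ℚ ℚ.+ t ℚ.* 1ℚ            ≡⟨ cong₂ ℚ._+_ (ℚ.*-identityʳ s) (ℚ.*-identityʳ t) ⟩
    s ℚ.+ t                          ≡⟨ s+t≡1 ⟩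
    1ℚ                               ∎
    where open ≡-Reasoning

  coordinate : ∀ (w : Fin n → ℚ) {z z′} →
    Σℚ n (λ i → λs i ℚ.* w i) ≡ z → Σℚ n (λ i → μs i ℚ.* w i) ≡ z′ →
    Σℚ n (λ i → ν i ℚ.* w i) ≡ s ℚ.* z ℚ.+ t ℚ.* z′
  coordinate w {z} {z′} Σλw≡z Σμw≡z′ = begin
    Σℚ n (λ i → ν i ℚ.* w i)
      ≡⟨ Σℚ-cong n (λ i → distrib (λs i) (μs i) (w i)) ⟩
    Σℚ n (λ i → s ℚ.* (λs i ℚ.* w i) ℚ.+ t ℚ.* (μs i ℚ.* w i))
      ≡⟨ Σℚ-linear n s t _ _ ⟩
    s ℚ.* Σℚ n (λ i → λs i ℚ.* w i) ℚ.+ t ℚ.* Σℚ n (λ i → μs i ℚ.* w i)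
      ≡⟨ cong₂ (λ p q → s ℚ.* p ℚ.+ t ℚ.* q) Σλw≡z Σμw≡z′ ⟩
    s ℚ.* z ℚ.+ t ℚ.* z′
      ∎
    where
    open ≡-Reasoning
    open ℚ.+-*-Solver
    distrib : ∀ a b c → (s ℚ.* a ℚ.+ t ℚ.* b) ℚ.* c ≡ s ℚ.* (a ℚ.* c) ℚ.+ t ℚ.* (b ℚ.* c)
    distrib = solve 5
      (λ s t a b c → (s :* a :+ t :* b) :* c := s :* (a :* c) :+ t :* (b :* c)) refl s t

InConvexHull-vertex : ∀ n v (i : Fin n) → InConvexHull n v (ιℚ (proj₁ (v i)) , ιℚ (proj₂ (v i)))
InConvexHull-vertex n v i =
  indicator i , indicator-nonNeg i , Σ1≡1 , Σℚ-indicator i _ , Σℚ-indicator i _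
  where
  Σ1≡1 : Σℚ n (indicator i) ≡ 1ℚ
  Σ1≡1 = trans (Σℚ-cong n (λ j → sym (ℚ.*-identityʳ (indicator i j))))
               (Σℚ-indicator i (λ _ → 1ℚ))

data Parity (z : ℤ) : Set where
  even : ∀ q → z ≡ + 2 * q → Parity z
  odd  : ∀ q → z ≡ + 1 + + 2 * q → Parity z

parity : ∀ z → Parity z
parity z with z ℤ.%ℕ 2 | ℤ.n%ℕd<d z 2 | ℤ.a≡a%ℕn+[a/ℕn]*n z 2
... | 0           | _            | z≡ = even q (trans z≡ (trans (ℤ.+-identityˡ _) (ℤ.*-comm q (+ 2))))
  where
  q : ℤ
  q = z ℤ./ℕ 2
... | 1           | _            | z≡ = odd q (trans z≡ (cong (_+_ (+ 1)) (ℤ.*-comm q (+ 2))))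
  where
  q : ℤ
  q = z ℤ./ℕ 2
... | suc (suc _) | s≤s (s≤s ()) | _

EvenSum : ℤ → ℤ → Set
EvenSum a b = ∃[ m ] a + b ≡ + 2 * m

even+even : ∀ {a b} p q → a ≡ + 2 * p → b ≡ + 2 * q → EvenSum a b
even+even p q refl refl = p + q , sym (ℤ.*-distribˡ-+ (+ 2) p q)

odd+odd : ∀ {a b} p q → a ≡ + 1 + + 2 * p → b ≡ + 1 + + 2 * q → EvenSum a b
odd+odd p q refl refl = + 1 + p + q , identity p q
  where
  identity : ∀ p q → (+ 1 + + 2 * p) + (+ 1 + + 2 * q) ≡ + 2 * (+ 1 + p + q)
  identity = solve-∀

evenSum-pigeonhole : ∀ {a b c} → Parity a → Parity b → Parity c →
                     EvenSum a b ⊎ EvenSum a c ⊎ EvenSum b c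
evenSum-pigeonhole (even p a≡) (even q b≡) _           = inj₁ (even+even p q a≡ b≡)
evenSum-pigeonhole (odd p a≡)  (odd q b≡)  _           = inj₁ (odd+odd p q a≡ b≡)
evenSum-pigeonhole (even p a≡) (odd _ _)   (even r c≡) = inj₂ (inj₁ (even+even p r a≡ c≡))
evenSum-pigeonhole (odd p a≡)  (even _ _)  (odd r c≡)  = inj₂ (inj₁ (odd+odd p r a≡ c≡))
evenSum-pigeonhole (even _ _)  (odd q b≡)  (odd r c≡)  = inj₂ (inj₂ (odd+odd q r b≡ c≡))
evenSum-pigeonhole (odd _ _)   (even q b≡) (even r c≡) = inj₂ (inj₂ (even+even q r b≡ c≡))

-- The reflective solver does not unfold det3, so identities about it are proved
-- through this copy in the syntax of the polynomial solver.
det3ᴾ : ∀ {k} (a₁ a₂ b₁ b₂ c₁ c₂ : +-*-Solver.Polynomial k) → +-*-Solver.Polynomial k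
det3ᴾ a₁ a₂ b₁ b₂ c₁ c₂ = (b₁ :- a₁) :* (c₂ :- a₂) :- (b₂ :- a₂) :* (c₁ :- a₁)
  where open +-*-Solver

det3-rotate : ∀ A B C → det3 B C A ≡ det3 A B C
det3-rotate (a₁ , a₂) (b₁ , b₂) (c₁ , c₂) =
  solve 6 (λ a₁ a₂ b₁ b₂ c₁ c₂ → det3ᴾ b₁ b₂ c₁ c₂ a₁ a₂ := det3ᴾ a₁ a₂ b₁ b₂ c₁ c₂)
    refl a₁ a₂ b₁ b₂ c₁ c₂
  where open +-*-Solver

det3-swap : ∀ A B C → det3 A C B ≡ - det3 A B C
det3-swap (a₁ , a₂) (b₁ , b₂) (c₁ , c₂) =
  solve 6 (λ a₁ a₂ b₁ b₂ c₁ c₂ → det3ᴾ a₁ a₂ c₁ c₂ b₁ b₂ := :- det3ᴾ a₁ a₂ b₁ b₂ c₁ c₂)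
    refl a₁ a₂ b₁ b₂ c₁ c₂
  where open +-*-Solver

record Midpoint (M A B : Point) : Set where
  constructor midpoint
  field
    x-sum : proj₁ A + proj₁ B ≡ + 2 * proj₁ M
    y-sum : proj₂ A + proj₂ B ≡ + 2 * proj₂ M

-- B = 2M - A, and det3 A B C is affine in B.
det3-midpoint : ∀ {M A B} C → Midpoint M A B → det3 A B C ≡ + 2 * det3 A M C
det3-midpoint {m₁ , m₂} {a₁ , a₂} {b₁ , b₂} (c₁ , c₂) (midpoint e₁ e₂) = begin
  det3 (a₁ , a₂) (b₁ , b₂) (c₁ , c₂)        ≡⟨ via-sum ⟩
  through (a₁ + b₁) (a₂ + b₂)               ≡⟨ cong₂ through e₁ e₂ ⟩
  through (+ 2 * m₁) (+ 2 * m₂)             ≡⟨ via-double ⟩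
  + 2 * det3 (a₁ , a₂) (m₁ , m₂) (c₁ , c₂)  ∎
  where
  open ≡-Reasoning
  open +-*-Solver

  through : ℤ → ℤ → ℤ
  through s t = det3 (a₁ , a₂) (s - a₁ , t - a₂) (c₁ , c₂)

  via-sum : det3 (a₁ , a₂) (b₁ , b₂) (c₁ , c₂) ≡ through (a₁ + b₁) (a₂ + b₂)
  via-sum = solve 6
    (λ a₁ a₂ b₁ b₂ c₁ c₂ →
      det3ᴾ a₁ a₂ b₁ b₂ c₁ c₂ := det3ᴾ a₁ a₂ (a₁ :+ b₁ :- a₁) (a₂ :+ b₂ :- a₂) c₁ c₂)
    refl a₁ a₂ b₁ b₂ c₁ c₂

  via-double : through (+ 2 * m₁) (+ 2 * m₂) ≡ + 2 * det3 (a₁ , a₂) (m₁ , m₂) (c₁ , c₂)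
  via-double = solve 6
    (λ a₁ a₂ m₁ m₂ c₁ c₂ →
      det3ᴾ a₁ a₂ (con (+ 2) :* m₁ :- a₁) (con (+ 2) :* m₂ :- a₂) c₁ c₂
        := con (+ 2) :* det3ᴾ a₁ a₂ m₁ m₂ c₁ c₂)
    refl a₁ a₂ m₁ m₂ c₁ c₂

area : Point → Point → Point → ℕ
area A B C = ℤ.∣ det3 A B C ∣

area-rotate : ∀ A B C → area B C A ≡ area A B C
area-rotate A B C = cong ℤ.∣_∣ (det3-rotate A B C)

area-swap : ∀ A B C → area A C B ≡ area A B C
area-swap A B C = trans (cong ℤ.∣_∣ (det3-swap A B C)) (ℤ.∣-i∣≡∣i∣ (det3 A B C))

area-midpoint : ∀ {M A B} C → Midpoint M A B → area A B C ≡ 2 ℕ.* area A M C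
area-midpoint {M} {A} C mid =
  trans (cong ℤ.∣_∣ (det3-midpoint C mid)) (ℤ.abs-* (+ 2) (det3 A M C))

half-of-positive : ∀ {m h} → m ≡ 2 ℕ.* h → 0 < m → 0 < h × h < m
half-of-positive {h = zero}  refl ()
half-of-positive {h = suc h} refl _ = ℕ.0<1+n , ℕ.m<m+n (suc h) ℕ.0<1+n

module _ {n : ℕ} (v : Fin n → Point) where

  InHull : Point → Set
  InHull (x , y) = InConvexHull n v (ιℚ x , ιℚ y)

  HasEvenLatticePoint : Set
  HasEvenLatticePoint = ∃[ u₁ ] ∃[ u₂ ] InHull (u₁ , + 2 * u₂)

  evenLatticePoint : ∀ x {y} q → y ≡ + 2 * q → InHull (x , y) → HasEvenLatticePoint
  evenLatticePoint x q refl p∈ = x , q , p∈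

  midpoint∈hull : ∀ {M A B} → Midpoint M A B → InHull A → InHull B → InHull M
  midpoint∈hull {A = a₁ , a₂} {B = b₁ , b₂} (midpoint e₁ e₂) A∈ B∈ =
    subst₂ (λ x y → InConvexHull n v (x , y)) (ιℚ-midpoint a₁ b₁ e₁) (ιℚ-midpoint a₂ b₂ e₂)
      (InConvexHull-convex {v = v} ½ ½ (ℚ.nonNegative⁻¹ ½) (ℚ.nonNegative⁻¹ ½) refl A∈ B∈)

  record HullTriangle (k : ℕ) : Set where
    constructor triangle
    field
      a b c : Point
      a∈ : InHull a
      b∈ : InHull b
      c∈ : InHull c
      area≡ : area a b c ≡ k

  rotate : ∀ {k} → HullTriangle k → HullTriangle k
  rotate (triangle a b c a∈ b∈ c∈ area≡) = triangle b c a b∈ c∈ a∈ (trans (area-rotate a b c) area≡)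

  swap : ∀ {k} → HullTriangle k → HullTriangle k
  swap (triangle a b c a∈ b∈ c∈ area≡) = triangle a c b a∈ c∈ b∈ (trans (area-swap a b c) area≡)

  Smaller : ℕ → Set
  Smaller k = ∃[ k′ ] 0 < k′ × k′ < k × HullTriangle k′

  halve : ∀ {k} → 0 < k → (t : HullTriangle k) →
    let open HullTriangle t in EvenSum (proj₁ a) (proj₁ b) → EvenSum (proj₂ a) (proj₂ b) → Smaller k
  halve 0<k (triangle a b c a∈ b∈ c∈ refl) (m₁ , e₁) (m₂ , e₂) =
    area a m c , proj₁ halved , proj₂ halved , triangle a m c a∈ (midpoint∈hull mid a∈ b∈) c∈ refl
    where
    m : Point
    m = m₁ , m₂

    mid : Midpoint m a b
    mid = midpoint e₁ e₂

    halved : 0 < area a m c × area a m c < area a b c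
    halved = half-of-positive (area-midpoint c mid) 0<k

  step : ∀ {k} → 0 < k → HullTriangle k → HasEvenLatticePoint ⊎ Smaller k
  step 0<k t@(triangle (a₁ , a₂) (b₁ , b₂) (c₁ , c₂) a∈ b∈ c∈ _)
    with parity a₂ | parity b₂ | parity c₂
  ... | even q a₂≡ | _ | _ = inj₁ (evenLatticePoint a₁ q a₂≡ a∈)
  ... | _ | even q b₂≡ | _ = inj₁ (evenLatticePoint b₁ q b₂≡ b∈)
  ... | _ | _ | even q c₂≡ = inj₁ (evenLatticePoint c₁ q c₂≡ c∈)
  ... | odd p a₂≡ | odd q b₂≡ | odd r c₂≡
    with evenSum-pigeonhole (parity a₁) (parity b₁) (parity c₁)
  ... | inj₁ ab        = inj₂ (halve 0<k t ab (odd+odd p q a₂≡ b₂≡))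
  ... | inj₂ (inj₁ ac) = inj₂ (halve 0<k (swap t) ac (odd+odd p r a₂≡ c₂≡))
  ... | inj₂ (inj₂ bc) = inj₂ (halve 0<k (rotate t) bc (odd+odd q r b₂≡ c₂≡))

  descend : ∀ {k} → 0 < k → HullTriangle k → Acc _<_ k → HasEvenLatticePoint
  descend 0<k t (acc smaller) with step 0<k t
  ... | inj₁ found = found
  ... | inj₂ (k′ , 0<k′ , k′<k , t′) = descend 0<k′ t′ (smaller k′<k)

mainTheorem1 : (n : ℕ) (v : Fin n → Point) → NonemptyInterior n v →
    ∃[ u₁ ] ∃[ u₂ ] InConvexHull n v (ιℚ u₁ , ιℚ (+ 2 * u₂))
mainTheorem1 n v (i , j , k , det≢0) =
  descend v (ℕ.n≢0⇒n>0 (det≢0 ∘ ℤ.∣i∣≡0⇒i≡0)) initial (<-wellFounded _)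
  where
  initial : HullTriangle v (area (v i) (v j) (v k))
  initial = triangle (v i) (v j) (v k)
    (InConvexHull-vertex n v i) (InConvexHull-vertex n v j) (InConvexHull-vertex n v k) refl
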